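{- Let $G$ be a finite simple graph, $u$ a vertex of $G$, and let $V_1,\ldots,V_\omega$ ($\omega\ge 1$) be the (vertex sets of the) connected components of $G\setminus N[u]$. If $V_i$ is a master component of $u$ with $D^*_u(V_i)\neq\emptyset$, then $D^*_u(V_j)\neq\emptyset$ for every component $V_j$ of $G\setminus N[u]$.
   Context: $N(x)$ is the neighborhood of $x$, $N[x]=N(x)\cup\{x\}$, and for a vertex set $W$, $N(W)=\bigcup_{w\in W}N(w)\setminus W$. For a component $V_i$ of $G\setminus N[u]$, $D_u(V_i)=\{V_p : 1\le p\le\omega,\ N(V_p)\subseteq N(V_i)\}$ (the neighborhood domination closure), and $D^*_u(V_i)=\{V_1,\ldots,V_\omega\}\setminus D_u(V_i)$. $V_i$ is a master component of $u$ if $|D_u(V_i)|\ge|D_u(V_j)|$ for all $j=1,\ldots,\omega$. -}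

module Defs where

open import Data.Nat using (ℕ; _≤_)
open import Data.Bool using (Bool; true; false; _∧_; not)
open import Data.Bool.ListAction using (any)
open import Data.Fin using (Fin)
open import Data.Fin.Subset using (Subset; _∈_; _∉_; _∪_; _∩_; ∁; ⁅_⁆; _⊆_; ∣_∣; Nonempty)
open import Data.Fin.Subset.Properties using (_⊆?_)
open import Data.List.Base using (allFin)
open import Data.Vec.Base using (tabulate; lookup)
open import Data.Product using (Σ; _×_)
open import Relation.Binary.PropositionalEquality using (_≡_; _≢_)
open import Relation.Nullary.Decidable using (does)
open import Function.Bundles using (_⇔_)

record SimpleGraph (n : ℕ) : Set where
  field
    adj    : Fin n → Fin n → Bool
    sym    : ∀ x y → adj x y ≡ adj y x
    irrefl : ∀ x → adj x x ≡ false
open SimpleGraph public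

module _ {n : ℕ} (G : SimpleGraph n) where

  N : Fin n → Subset n
  N x = tabulate (λ y → adj G x y)

  N[_] : Fin n → Subset n
  N[ x ] = N x ∪ ⁅ x ⁆

  -- N(W) = (⋃_{w ∈ W} N(w)) ∖ W
  NSet : Subset n → Subset n
  NSet W = tabulate (λ y → any (λ w → lookup W w ∧ adj G w y) (allFin n) ∧ not (lookup W y))

  -- Walks inside the induced subgraph G[S]: Reach S x y iff there is a walk
  -- from x to y all of whose vertices lie in S.
  data Reach (S : Subset n) (x : Fin n) : Fin n → Set where
    here : x ∈ S → Reach S x x
    step : ∀ {y z} → Reach S x y → adj G y z ≡ true → z ∈ S → Reach S x z

  IsComponent : Subset n → Subset n → Set
  IsComponent S C = Σ (Fin n) λ x → (x ∈ S) × (∀ y → (y ∈ C) ⇔ Reach S x y)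

  IsComponentEnumeration : (u : Fin n) (ω : ℕ) → (Fin ω → Subset n) → Set
  IsComponentEnumeration u ω V =
      (∀ p → IsComponent (∁ N[ u ]) (V p))
    × (∀ p q → V p ≡ V q → p ≡ q)
    × (∀ C → IsComponent (∁ N[ u ]) C → Σ (Fin ω) λ p → V p ≡ C)

  module _ {ω : ℕ} (V : Fin ω → Subset n) where

    -- D_u(V_i) as a set of component indices: { p | N(V_p) ⊆ N(V_i) }
    D : Fin ω → Subset ω
    D i = tabulate (λ p → does (NSet (V p) ⊆? NSet (V i)))

    D* : Fin ω → Subset ω
    D* i = ∁ (D i)

    IsMaster : Fin ω → Set
    IsMaster i = ∀ j → ∣ D j ∣ ≤ ∣ D i ∣

module Submission where

-- Index the components V₁,…,V_ω by Fin ω; then D_u(V_j) is a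
-- subset of Fin ω and D*_u(V_j) is its complement.  The lemma is a pure
-- counting fact about any family of subsets of a finite set:
--   if some D*_u(V_j) were empty, then D_u(V_j) would be all of Fin ω and
--   have size ω; a master component V_i has |D_u(V_i)| ≥ |D_u(V_j)| = ω,
--   so D_u(V_i) is all of Fin ω too, contradicting D*_u(V_i) ≠ ∅.

open import Defs
open import Data.Nat using (ℕ; _≤_)
open import Data.Nat.Properties using (≤-antisym; module ≤-Reasoning)
open import Data.Fin using (Fin)
open import Data.Fin.Subset using (Subset; Nonempty; Empty; ⊤; ∁; ∣_∣; _∈_)
open import Data.Fin.Subset.Properties
  using (nonempty?; ∈⊤; ⊆⊤; ⊆-antisym; x∉∁p⇒x∈p; x∈∁p⇒x∉p; ∣p∣≤n; ∣p∣≡n⇒p≡⊤; ∣⊤∣≡n)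
open import Data.Empty using (⊥-elim)
open import Data.Product using (_,_)
open import Relation.Nullary using (yes; no)
open import Relation.Binary.PropositionalEquality using (_≡_; subst; cong) renaming (sym to ≡-sym)

empty-complement⇒full : ∀ {m} (p : Subset m) → Empty (∁ p) → p ≡ ⊤
empty-complement⇒full p empty =
  ⊆-antisym ⊆⊤ (λ {x} _ → x∉∁p⇒x∈p (λ x∈∁p → empty (x , x∈∁p)))

large⇒full : ∀ {m} (p : Subset m) → m ≤ ∣ p ∣ → p ≡ ⊤
large⇒full p m≤∣p∣ = ∣p∣≡n⇒p≡⊤ (≤-antisym (∣p∣≤n p) m≤∣p∣)

full⇒empty-complement : ∀ {m} (p : Subset m) → p ≡ ⊤ → Empty (∁ p)
full⇒empty-complement p p≡⊤ (x , x∈∁p) = x∈∁p⇒x∉p x∈∁p (subst (x ∈_) (≡-sym p≡⊤) ∈⊤)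

-- In any family of subsets of Fin m, if a member of maximum size is a
-- proper subset, then every member is a proper subset: a full member would
-- have size m and force the maximum to be full as well.
maximum-proper⇒all-proper : ∀ {a m} {I : Set a} (F : I → Subset m) (i : I)
  → (∀ j → ∣ F j ∣ ≤ ∣ F i ∣)
  → Nonempty (∁ (F i))
  → ∀ j → Nonempty (∁ (F j))
maximum-proper⇒all-proper {m = m} F i maximum proper j with nonempty? (∁ (F j))
... | yes properⱼ = properⱼ
... | no  fullⱼ  = ⊥-elim (full⇒empty-complement (F i) (large⇒full (F i) m≤∣Fi∣) proper)
  where
  open ≤-Reasoning
  m≤∣Fi∣ : m ≤ ∣ F i ∣
  m≤∣Fi∣ = begin
    m           ≡⟨ ≡-sym (∣⊤∣≡n m) ⟩
    ∣ ⊤ {m} ∣   ≡⟨ cong ∣_∣ (≡-sym (empty-complement⇒full (F j) fullⱼ)) ⟩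
    ∣ F j ∣     ≤⟨ maximum j ⟩
    ∣ F i ∣     ∎

lemma2p4 : ∀ {n : ℕ} (G : SimpleGraph n) (u : Fin n) (ω : ℕ) (V : Fin ω → Subset n)
           → 1 ≤ ω
           → IsComponentEnumeration G u ω V
           → (i : Fin ω)
           → IsMaster G V i
           → Nonempty (D* G V i)
           → ∀ (j : Fin ω) → Nonempty (D* G V j)
lemma2p4 G u ω V _ _ i master = maximum-proper⇒all-proper (D G V) i master
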